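{- Let $H:\mathbb N\to\mathbb N$ be defined by $H(0)=0$ and $H(i)=i-H(H(H(i-1)))$ for $i\ge1$. Let $(A(n))_{n\ge1}$ be the increasing enumeration of the natural numbers that occur exactly twice among the values $H(0),H(1),H(2),\dots$ (so $A=1,4,5,7,10,\dots$), and let $(B(n))_{n\ge1}$ be the increasing enumeration of the positive integers whose Narayana representation ends in the digit $1$ (so $B=1,5,7,10,14,\dots$). Then $A(n)+n-1=B(n)$ for all $n\ge1$.
   Context: The Narayana numbers are defined by $N_0=1$, $N_1=2$, $N_2=3$, $N_i=N_{i-1}+N_{i-3}$ for $i\ge3$. The Narayana representation of a positive integer $m$ is the unique binary word $e_1\cdots e_t$ with $e_1=1$, no factor $11$ or $101$, and $m=\sum_{i=1}^t e_iN_{t-i}$. -}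

module Defs where

open import Data.Nat using (ℕ; zero; suc; _+_; _∸_; _<_; _≤_)
open import Data.Bool using (Bool; true; false; if_then_else_)
open import Data.List using (List; []; _∷_; _++_; length; last)
open import Data.Maybe using (just)
open import Data.Product using (Σ; ∃; ∃-syntax; _×_; _,_)
open import Data.Sum using (_⊎_)
open import Relation.Nullary using (¬_)
open import Relation.Binary.PropositionalEquality using (_≡_)

N : ℕ → ℕ
N 0 = 1
N 1 = 2
N 2 = 3
N (suc (suc (suc i))) = N (suc (suc i)) + N i

-- A binary word e₁ ⋯ eₜ is a list of Bools (true = digit 1), e₁ first.
-- Its value is Σ_{i=1}^t e_i N_{t-i}.
value : List Bool → ℕ
value [] = 0
value (e ∷ w) = (if e then N (length w) else 0) + value w

Factor : List Bool → List Bool → Set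
Factor u w = ∃[ xs ] ∃[ ys ] (xs ++ u ++ ys ≡ w)

NarayanaRep : ℕ → List Bool → Set
NarayanaRep m w =
  (∃[ w' ] (w ≡ true ∷ w'))
  × ¬ Factor (true ∷ true ∷ []) w
  × ¬ Factor (true ∷ false ∷ true ∷ []) w
  × value w ≡ m

NarEndsIn1 : ℕ → Set
NarEndsIn1 m = 1 ≤ m × ∃[ w ] (NarayanaRep m w × last w ≡ just true)

OccursExactlyTwice : (ℕ → ℕ) → ℕ → Set
OccursExactlyTwice H v =
  ∃[ i ] ∃[ j ] (i < j × H i ≡ v × H j ≡ v × (∀ k → H k ≡ v → k ≡ i ⊎ k ≡ j))

-- E : ℕ → ℕ (indexed from 1, E 0 irrelevant) is the increasing enumeration
-- of the set S: strictly increasing on indices ≥ 1, with image exactly S.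
IsIncreasingEnumeration : (ℕ → Set) → (ℕ → ℕ) → Set
IsIncreasingEnumeration S E =
  (∀ m n → 1 ≤ m → m < n → E m < E n)
  × (∀ n → 1 ≤ n → S (E n))
  × (∀ v → S v → ∃[ n ] (1 ≤ n × E n ≡ v))

-- H has unit steps, and its plateaus i (where H (i + 1) = H i) are isolated, so the
-- values taken exactly twice are the values of H at plateaus, and H i + #{plateaus
-- below i} = i. The heart of the matter is the self-similarity
--   H (N (3 + s) + y) = N (2 + s) + H y   for y ≤ N (2 + s),
-- proved by strong induction from the recurrence. It shows that i ↦ N (3 + s) + i
-- preserves plateaus, just as prepending 1 0 0 0ʲ to a Narayana representation
-- preserves its last digit; hence the plateaus are exactly the numbers whose
-- representation ends in 1. If B n is the n-th plateau, A n = H (B n) = B n - (n - 1).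

module Submission where

open import Defs
open import Data.Bool using (Bool; true; false)
open import Data.Empty using (⊥-elim)
open import Data.List using (List; []; _∷_; _++_; length; last; replicate)
open import Data.List.Properties using (length-++; length-replicate)
open import Data.Maybe using (just)
open import Data.Nat using (ℕ; zero; suc; _+_; _∸_; _≤_; _<_; z≤n; s≤s)
open import Data.Nat.Induction using (<-rec)
open import Data.Nat.Properties
open import Data.Nat.Tactic.RingSolver using (solve-∀)
open import Data.Product using (∃-syntax; _×_; _,_; proj₁; proj₂)
open import Data.Sum using (_⊎_; inj₁; inj₂)
open import Function using (_∘_)
open import Function.Bundles using (_⇔_; mk⇔; module Equivalence)
open import Function.Construct.Composition using (_⇔-∘_)
open import Function.Construct.Symmetry using (⇔-sym)
open import Relation.Binary using (tri<; tri≈; tri>)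
open import Relation.Binary.PropositionalEquality
open import Relation.Nullary using (¬_; yes; no)

open Equivalence using (to; from)

-- Narayana numbers

1≤N : ∀ k → 1 ≤ N k
1≤N 0 = s≤s z≤n
1≤N 1 = s≤s z≤n
1≤N 2 = s≤s z≤n
1≤N (suc (suc (suc k))) = ≤-trans (1≤N (suc (suc k))) (m≤m+n _ _)

N<N[1+k] : ∀ k → N k < N (suc k)
N<N[1+k] 0 = s≤s (s≤s z≤n)
N<N[1+k] 1 = s≤s (s≤s (s≤s z≤n))
N<N[1+k] (suc (suc k)) = m<m+n (N (2 + k)) (1≤N k)

N-mono-< : ∀ {j k} → j < k → N j < N k
N-mono-< {j} {suc k} (s≤s j≤k) with m≤n⇒m<n∨m≡n j≤k
... | inj₁ j<k = <-trans (N-mono-< j<k) (N<N[1+k] k)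
... | inj₂ refl = N<N[1+k] j

N-mono-≤ : ∀ {j k} → j ≤ k → N j ≤ N k
N-mono-≤ j≤k with m≤n⇒m<n∨m≡n j≤k
... | inj₁ j<k = <⇒≤ (N-mono-< j<k)
... | inj₂ refl = ≤-refl

N-cancel-< : ∀ {j k} → N j < N k → j < k
N-cancel-< {j} {k} Nj<Nk with j <? k
... | yes j<k = j<k
... | no j≮k = ⊥-elim (<⇒≱ Nj<Nk (N-mono-≤ (≮⇒≥ j≮k)))

N[1+k]≡N[k]+N[k∸2] : ∀ k → N (suc k) ≡ N k + N (k ∸ 2)
N[1+k]≡N[k]+N[k∸2] 0 = refl
N[1+k]≡N[k]+N[k∸2] 1 = refl
N[1+k]≡N[k]+N[k∸2] (suc (suc k)) = refl

N-floor-unique : ∀ {j k x} → N j ≤ x → x < N (suc j) → N k ≤ x → x < N (suc k) → j ≡ k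
N-floor-unique {j} {k} Nj≤x x<Nj' Nk≤x x<Nk' with <-cmp j k
... | tri≈ _ j≡k _ = j≡k
... | tri< j<k _ _ = ⊥-elim (<⇒≱ x<Nj' (≤-trans (N-mono-≤ j<k) Nk≤x))
... | tri> _ _ k<j = ⊥-elim (<⇒≱ x<Nk' (≤-trans (N-mono-≤ k<j) Nj≤x))

-- Greedy (Zeckendorf-type) decomposition, built by counting up from 1: when the
-- remainder reaches N (k ∸ 2), the next number is N k + N (k ∸ 2) = N (suc k).
greedy-decomposition : ∀ m → 1 ≤ m → ∃[ k ] ∃[ y ] (m ≡ N k + y × y < N (k ∸ 2))
greedy-decomposition 1 _ = 0 , 0 , refl , s≤s z≤n
greedy-decomposition (suc (suc m)) _ with greedy-decomposition (suc m) (s≤s z≤n)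
... | k , y , m+1≡ , y<N with suc y <? N (k ∸ 2)
...   | yes y+1<N = k , suc y , trans (cong suc m+1≡) (sym (+-suc (N k) y)) , y+1<N
...   | no y+1≮N = suc k , 0 , m+2≡ , 1≤N (suc k ∸ 2)
  where
  open ≡-Reasoning
  m+2≡ : suc (suc m) ≡ N (suc k) + 0
  m+2≡ = begin
    suc (suc m)          ≡⟨ cong suc m+1≡ ⟩
    suc (N k + y)        ≡⟨ +-suc (N k) y ⟨
    N k + suc y          ≡⟨ cong (N k +_) (≤-antisym y<N (≮⇒≥ y+1≮N)) ⟩
    N k + N (k ∸ 2)      ≡⟨ N[1+k]≡N[k]+N[k∸2] k ⟨
    N (suc k)            ≡⟨ +-identityʳ _ ⟨
    N (suc k) + 0        ∎

narayana-induction : (P : ℕ → Set) → P 0 → (∀ k → P (N k))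
  → (∀ s y → 1 ≤ y → y < N (suc s) → P y → P (N (3 + s) + y))
  → ∀ m → P m
narayana-induction P P0 PN Pshift = <-rec P step
  where
  step : ∀ m → (∀ {m'} → m' < m → P m') → P m
  step zero _ = P0
  step (suc m) ih with greedy-decomposition (suc m) (s≤s z≤n)
  ... | k , zero , m≡ , _ = subst P (sym (trans m≡ (+-identityʳ (N k)))) (PN k)
  ... | 0 , suc y , _ , s≤s ()
  ... | 1 , suc y , _ , s≤s ()
  ... | 2 , suc y , _ , s≤s ()
  ... | suc (suc (suc s)) , suc y , m≡ , y<N =
    subst P (sym m≡) (Pshift s (suc y) (s≤s z≤n) y<N (ih y<m))
    where
    y<m : suc y < suc m
    y<m = subst (suc y <_) (sym m≡) (+-monoˡ-≤ (suc y) (1≤N (3 + s)))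

-- Narayana representations

data Admissible : List Bool → Set where
  []    : Admissible []
  0∷_   : ∀ {w} → Admissible w → Admissible (false ∷ w)
  [1]   : Admissible (true ∷ [])
  [10]  : Admissible (true ∷ false ∷ [])
  100∷_ : ∀ {w} → Admissible w → Admissible (true ∷ false ∷ false ∷ w)

admissible-tail : ∀ {x w} → Admissible (x ∷ w) → Admissible w
admissible-tail (0∷ a) = a
admissible-tail [1] = []
admissible-tail [10] = 0∷ []
admissible-tail (100∷ a) = 0∷ 0∷ a

admissible⇒¬11 : ∀ {w} → Admissible w → ¬ Factor (true ∷ true ∷ []) w
admissible⇒¬11 a ([] , ys , refl) with a
... | ()
admissible⇒¬11 a (x ∷ xs , ys , refl) = admissible⇒¬11 (admissible-tail a) (xs , ys , refl)

admissible⇒¬101 : ∀ {w} → Admissible w → ¬ Factor (true ∷ false ∷ true ∷ []) w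
admissible⇒¬101 a ([] , ys , refl) with a
... | ()
admissible⇒¬101 a (x ∷ xs , ys , refl) = admissible⇒¬101 (admissible-tail a) (xs , ys , refl)

¬Factor-∷ : ∀ {u x w} → ¬ Factor u (x ∷ w) → ¬ Factor u w
¬Factor-∷ {x = x} ¬f (xs , ys , eq) = ¬f (x ∷ xs , ys , cong (x ∷_) eq)

¬factors⇒admissible : ∀ w → ¬ Factor (true ∷ true ∷ []) w → ¬ Factor (true ∷ false ∷ true ∷ []) w
                      → Admissible w
¬factors⇒admissible [] _ _ = []
¬factors⇒admissible (false ∷ w) ¬11 ¬101 = 0∷ ¬factors⇒admissible w (¬Factor-∷ ¬11) (¬Factor-∷ ¬101)
¬factors⇒admissible (true ∷ []) _ _ = [1]
¬factors⇒admissible (true ∷ true ∷ w) ¬11 _ = ⊥-elim (¬11 ([] , w , refl))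
¬factors⇒admissible (true ∷ false ∷ []) _ _ = [10]
¬factors⇒admissible (true ∷ false ∷ true ∷ w) _ ¬101 = ⊥-elim (¬101 ([] , w , refl))
¬factors⇒admissible (true ∷ false ∷ false ∷ w) ¬11 ¬101 =
  100∷ ¬factors⇒admissible w (¬Factor-∷ (¬Factor-∷ (¬Factor-∷ ¬11)))
                             (¬Factor-∷ (¬Factor-∷ (¬Factor-∷ ¬101)))

rep⇒admissible : ∀ {m w} → NarayanaRep m w → Admissible w
rep⇒admissible {w = w} (_ , ¬11 , ¬101 , _) = ¬factors⇒admissible w ¬11 ¬101

admissible⇒rep : ∀ {w} → Admissible (true ∷ w) → NarayanaRep (value (true ∷ w)) (true ∷ w)
admissible⇒rep {w} a = (w , refl) , admissible⇒¬11 a , admissible⇒¬101 a , refl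

value<N[length] : ∀ {w} → Admissible w → value w < N (length w)
value<N[length] [] = s≤s z≤n
value<N[length] {false ∷ w} (0∷ a) = <-trans (value<N[length] a) (N<N[1+k] (length w))
value<N[length] [1] = s≤s (s≤s z≤n)
value<N[length] [10] = s≤s (s≤s (s≤s z≤n))
value<N[length] {true ∷ false ∷ false ∷ w} (100∷ a) = +-monoʳ-< (N (2 + length w)) (value<N[length] a)

zeros : ℕ → List Bool
zeros j = replicate j false

value-zeros : ∀ j w → value (zeros j ++ w) ≡ value w
value-zeros zero w = refl
value-zeros (suc j) w = value-zeros j w

admissible-zeros : ∀ j {w} → Admissible w → Admissible (zeros j ++ w)
admissible-zeros zero a = a
admissible-zeros (suc j) a = 0∷ admissible-zeros j a

admissible-zeros⁻ : ∀ j {w} → Admissible (zeros j ++ w) → Admissible w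
admissible-zeros⁻ zero a = a
admissible-zeros⁻ (suc j) a = admissible-zeros⁻ j (admissible-tail a)

last-zeros : ∀ j x w → last (x ∷ zeros j ++ true ∷ w) ≡ last (true ∷ w)
last-zeros zero x w = refl
last-zeros (suc j) x w = last-zeros j false w

1≤value⇒zeros++1∷ : ∀ u → 1 ≤ value u → ∃[ j ] ∃[ w ] (u ≡ zeros j ++ true ∷ w)
1≤value⇒zeros++1∷ (true ∷ w) _ = 0 , w , refl
1≤value⇒zeros++1∷ (false ∷ u) 1≤v with 1≤value⇒zeros++1∷ u 1≤v
... | j , w , refl = suc j , w , refl

value≡0⇒last≢1 : ∀ w → value w ≡ 0 → ¬ last w ≡ just true
value≡0⇒last≢1 (true ∷ w) v≡0 _ = <⇒≢ (≤-trans (1≤N (length w)) (m≤m+n _ _)) (sym v≡0)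
value≡0⇒last≢1 (false ∷ []) _ ()
value≡0⇒last≢1 (false ∷ x ∷ w) v≡0 = value≡0⇒last≢1 (x ∷ w) v≡0

leading-length : ∀ k {u y} → Admissible (true ∷ u) → value (true ∷ u) ≡ N k + y → y < N (k ∸ 2)
                 → length u ≡ k
leading-length k {u} {y} a v≡ y<N = N-floor-unique
  (subst (N (length u) ≤_) v≡ (m≤m+n _ _))
  (subst (_< N (suc (length u))) v≡ (value<N[length] a))
  (m≤m+n (N k) y)
  (<-≤-trans (+-monoʳ-< (N k) y<N) (≤-reflexive (sym (N[1+k]≡N[k]+N[k∸2] k))))

leading-value : ∀ k {u y} → Admissible (true ∷ u) → value (true ∷ u) ≡ N k + y → y < N (k ∸ 2)
                → value u ≡ y
leading-value k {u} a v≡ y<N =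
  +-cancelˡ-≡ (N k) _ _ (trans (cong (λ l → N l + value u) (sym (leading-length k a v≡ y<N))) v≡)

admissible⇒NarEndsIn1 : ∀ {w m} → Admissible (true ∷ w) → value (true ∷ w) ≡ m
                        → last (true ∷ w) ≡ just true → NarEndsIn1 m
admissible⇒NarEndsIn1 {w} a refl last≡ =
  ≤-trans (1≤N (length w)) (m≤m+n _ _) , true ∷ w , admissible⇒rep a , last≡

NarEndsIn1-1 : NarEndsIn1 1
NarEndsIn1-1 = admissible⇒NarEndsIn1 [1] refl refl

NarEndsIn1-N⇒k≡0 : ∀ {k} → NarEndsIn1 (N k) → k ≡ 0
NarEndsIn1-N⇒k≡0 (_ , [] , ((_ , ()) , _) , _)
NarEndsIn1-N⇒k≡0 (_ , false ∷ _ , ((_ , ()) , _) , _)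
NarEndsIn1-N⇒k≡0 {k} (_ , true ∷ [] , rep@(_ , _ , _ , v≡) , _) =
  sym (leading-length k (rep⇒admissible rep) (trans v≡ (sym (+-identityʳ (N k)))) (1≤N (k ∸ 2)))
NarEndsIn1-N⇒k≡0 {k} (_ , true ∷ x ∷ u , rep@(_ , _ , _ , v≡) , last≡) =
  ⊥-elim (value≡0⇒last≢1 (x ∷ u) value≡0 last≡)
  where
  value≡0 : value (x ∷ u) ≡ 0
  value≡0 = leading-value k (rep⇒admissible rep) (trans v≡ (sym (+-identityʳ (N k)))) (1≤N (k ∸ 2))

NarEndsIn1-N : ∀ k → NarEndsIn1 (N k) ⇔ k ≡ 0
NarEndsIn1-N k = mk⇔ NarEndsIn1-N⇒k≡0 λ { refl → NarEndsIn1-1 }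

-- Narayana representations of N (3 + s) + y and of y differ by the prefix 1 0 0 0ʲ.
NarEndsIn1-shift : ∀ s y → 1 ≤ y → y < N (suc s) → NarEndsIn1 (N (3 + s) + y) ⇔ NarEndsIn1 y
NarEndsIn1-shift s y 1≤y y<N = mk⇔ drop-prefix add-prefix
  where
  drop-prefix : NarEndsIn1 (N (3 + s) + y) → NarEndsIn1 y
  drop-prefix (_ , [] , ((_ , ()) , _) , _)
  drop-prefix (_ , false ∷ _ , ((_ , ()) , _) , _)
  drop-prefix (_ , true ∷ u , rep@(_ , _ , _ , v≡) , last≡)
    with leading-value (3 + s) (rep⇒admissible rep) v≡ y<N
  ... | u≡y with 1≤value⇒zeros++1∷ u (subst (1 ≤_) (sym u≡y) 1≤y)
  ...   | j , w , refl =
    admissible⇒NarEndsIn1 (admissible-zeros⁻ j (admissible-tail (rep⇒admissible rep)))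
      (trans (sym (value-zeros j (true ∷ w))) u≡y) (trans (sym (last-zeros j true w)) last≡)

  add-prefix : NarEndsIn1 y → NarEndsIn1 (N (3 + s) + y)
  add-prefix (_ , [] , ((_ , ()) , _) , _)
  add-prefix (_ , false ∷ _ , ((_ , ()) , _) , _)
  add-prefix (_ , true ∷ w , rep@(_ , _ , _ , v≡) , last≡) =
    admissible⇒NarEndsIn1 (100∷ admissible-zeros j a) value≡ (trans (last-zeros j false w) last≡)
    where
    a = rep⇒admissible rep
    L = length w
    L≤s : L ≤ s
    L≤s = ≤-pred (N-cancel-< (≤-<-trans (subst (N L ≤_) v≡ (m≤m+n _ _)) y<N))
    j = s ∸ L
    open ≡-Reasoning
    length≡ : 2 + length (zeros j ++ true ∷ w) ≡ 3 + s
    length≡ = begin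
      2 + length (zeros j ++ true ∷ w)   ≡⟨ cong (2 +_) (length-++ (zeros j)) ⟩
      2 + (length (zeros j) + suc L)     ≡⟨ cong (λ l → 2 + (l + suc L)) (length-replicate j) ⟩
      2 + (j + suc L)                    ≡⟨ cong (2 +_) (+-suc j L) ⟩
      3 + (j + L)                        ≡⟨ cong (3 +_) (m∸n+n≡m L≤s) ⟩
      3 + s                              ∎
    value≡ : value (true ∷ false ∷ false ∷ zeros j ++ true ∷ w) ≡ N (3 + s) + y
    value≡ = cong₂ _+_ (cong N length≡) (trans (value-zeros j (true ∷ w)) v≡)

-- Increasing enumerations

module _ {S : ℕ → Set} {E : ℕ → ℕ} (enum : IsIncreasingEnumeration S E) where

  private
    E-inc : ∀ m n → 1 ≤ m → m < n → E m < E n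
    E-inc = proj₁ enum
    E-surj : ∀ v → S v → ∃[ n ] (1 ≤ n × E n ≡ v)
    E-surj = proj₂ (proj₂ enum)

  enum-mono-≤ : ∀ {m n} → 1 ≤ m → m ≤ n → E m ≤ E n
  enum-mono-≤ {m} {n} 1≤m m≤n with m≤n⇒m<n∨m≡n m≤n
  ... | inj₁ m<n = <⇒≤ (E-inc m n 1≤m m<n)
  ... | inj₂ refl = ≤-refl

  enum-cancel-< : ∀ {m n} → 1 ≤ n → E m < E n → m < n
  enum-cancel-< {m} {n} 1≤n Em<En with m <? n
  ... | yes m<n = m<n
  ... | no m≮n = ⊥-elim (<⇒≱ Em<En (enum-mono-≤ 1≤n (≮⇒≥ m≮n)))

  enum-below : ∀ {j n} → S j → j < E (suc n) → ∃[ m ] (1 ≤ m × m ≤ n × E m ≡ j)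
  enum-below Sj j<E with E-surj _ Sj
  ... | m , 1≤m , Em≡j = m , 1≤m , ≤-pred (enum-cancel-< (s≤s z≤n) (subst (_< _) (sym Em≡j) j<E)) , Em≡j

enum-cong : ∀ {S S' E} → (∀ v → S v ⇔ S' v) → IsIncreasingEnumeration S E → IsIncreasingEnumeration S' E
enum-cong S⇔S' (inc , mem , surj) =
  inc , (λ n 1≤n → to (S⇔S' _) (mem n 1≤n)) , (λ v S'v → surj v (from (S⇔S' v) S'v))

enum-map : ∀ {S E} (f : ℕ → ℕ) → IsIncreasingEnumeration S E → (∀ {i j} → S i → S j → i < j → f i < f j)
           → IsIncreasingEnumeration (λ v → ∃[ i ] (S i × f i ≡ v)) (λ n → f (E n))
enum-map f (inc , mem , surj) f-strict =
  (λ m n 1≤m m<n → f-strict (mem m 1≤m) (mem n (≤-trans 1≤m (<⇒≤ m<n))) (inc m n 1≤m m<n)) ,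
  (λ n 1≤n → _ , mem n 1≤n , refl) ,
  λ { v (i , Si , refl) → let (n , 1≤n , Eₙ≡i) = surj i Si in n , 1≤n , cong f Eₙ≡i }

private
  -- E n < E' n would give E n = E' m for some m < n, but E' m = E m < E n.
  enum-not-behind : ∀ {S E E'} → IsIncreasingEnumeration S E → IsIncreasingEnumeration S E'
                    → ∀ n → 1 ≤ n → (∀ m → m < n → 1 ≤ m → E m ≡ E' m) → ¬ E n < E' n
  enum-not-behind enum@(inc , mem , _) enum'@(_ , _ , surj') n 1≤n agree En<E'n
    with surj' _ (mem n 1≤n)
  ... | m , 1≤m , E'm≡En with enum-cancel-< enum' 1≤n (subst (_< _) (sym E'm≡En) En<E'n)
  ...   | m<n = <-irrefl (trans (agree m m<n 1≤m) E'm≡En) (inc m n 1≤m m<n)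

enum-unique : ∀ {S E E'} → IsIncreasingEnumeration S E → IsIncreasingEnumeration S E'
              → ∀ n → 1 ≤ n → E n ≡ E' n
enum-unique {S} {E} {E'} enum enum' = <-rec (λ n → 1 ≤ n → E n ≡ E' n) step
  where
  step : ∀ n → (∀ {m} → m < n → 1 ≤ m → E m ≡ E' m) → 1 ≤ n → E n ≡ E' n
  step n ih 1≤n = ≤-antisym
    (≮⇒≥ (enum-not-behind enum' enum n 1≤n λ m m<n 1≤m → sym (ih m<n 1≤m)))
    (≮⇒≥ (enum-not-behind enum enum' n 1≤n λ m m<n 1≤m → ih m<n 1≤m))

-- Functions with unit steps

UnitStep : ℕ → ℕ → Set
UnitStep x y = y ≡ x ⊎ y ≡ suc x

module UnitSteps (f : ℕ → ℕ) (unit-step : ∀ i → UnitStep (f i) (f (suc i))) where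

  Plateau : ℕ → Set
  Plateau i = f (suc i) ≡ f i

  ¬plateau⇒f-suc : ∀ {i} → ¬ Plateau i → f (suc i) ≡ suc (f i)
  ¬plateau⇒f-suc {i} ¬p with unit-step i
  ... | inj₁ p = ⊥-elim (¬p p)
  ... | inj₂ f-suc = f-suc

  f-≤-+ : ∀ d x → f x ≤ f (d + x)
  f-≤-+ zero x = ≤-refl
  f-≤-+ (suc d) x with unit-step (d + x)
  ... | inj₁ p = subst (f x ≤_) (sym p) (f-≤-+ d x)
  ... | inj₂ f-suc = subst (f x ≤_) (sym f-suc) (m≤n⇒m≤1+n (f-≤-+ d x))

  f-mono-≤ : ∀ {x y} → x ≤ y → f x ≤ f y
  f-mono-≤ {x} x≤y = subst (λ z → f x ≤ f z) (m∸n+n≡m x≤y) (f-≤-+ _ x)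

  f-+-without-plateaus : ∀ a t → (∀ j → a ≤ j → j < a + t → ¬ Plateau j) → f (a + t) ≡ f a + t
  f-+-without-plateaus a zero _ = trans (cong f (+-identityʳ a)) (sym (+-identityʳ (f a)))
  f-+-without-plateaus a (suc t) no-plateau = begin
    f (a + suc t)     ≡⟨ cong f (+-suc a t) ⟩
    f (suc (a + t))   ≡⟨ ¬plateau⇒f-suc (no-plateau (a + t) (m≤m+n a t) a+t<a+1+t) ⟩
    suc (f (a + t))   ≡⟨ cong suc (f-+-without-plateaus a t no-plateau′) ⟩
    suc (f a + t)     ≡⟨ +-suc (f a) t ⟨
    f a + suc t       ∎
    where
    open ≡-Reasoning
    a+t<a+1+t : a + t < a + suc t
    a+t<a+1+t = +-monoʳ-< a (n<1+n t)
    no-plateau′ : ∀ j → a ≤ j → j < a + t → ¬ Plateau j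
    no-plateau′ j a≤j j<a+t = no-plateau j a≤j (<-trans j<a+t a+t<a+1+t)

  f[E[n]]+[n∸1]≡E[n] : f 0 ≡ 0 → ∀ {E} → IsIncreasingEnumeration Plateau E
                       → ∀ n → 1 ≤ n → f (E n) + (n ∸ 1) ≡ E n
  f[E[n]]+[n∸1]≡E[n] f0≡0 {E} enum 1 _ = begin
    f (E 1) + 0     ≡⟨ +-identityʳ _ ⟩
    f (E 1)         ≡⟨ f-+-without-plateaus 0 (E 1) no-plateau ⟩
    f 0 + E 1       ≡⟨ cong (_+ E 1) f0≡0 ⟩
    E 1             ∎
    where
    open ≡-Reasoning
    no-plateau : ∀ j → 0 ≤ j → j < E 1 → ¬ Plateau j
    no-plateau j _ j<E₁ p with enum-below enum p j<E₁
    ... | _ , 1≤m , m≤0 , _ = <⇒≱ 1≤m m≤0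
  f[E[n]]+[n∸1]≡E[n] f0≡0 {E} enum@(inc , mem , _) (suc (suc n)) _ = begin
    f (E (2 + n)) + suc n       ≡⟨ cong (λ x → f x + suc n) (m+[n∸m]≡n Eₙ₊₁<Eₙ₊₂) ⟨
    f (a + t) + suc n           ≡⟨ cong (_+ suc n) (f-+-without-plateaus a t no-plateau) ⟩
    f a + t + suc n             ≡⟨ cong (λ x → x + t + suc n) (mem (suc n) (s≤s z≤n)) ⟩
    f (E (suc n)) + t + suc n   ≡⟨ rearrange (f (E (suc n))) t n ⟩
    suc (f (E (suc n)) + n) + t ≡⟨ cong (λ x → suc x + t)
                                     (f[E[n]]+[n∸1]≡E[n] f0≡0 enum (suc n) (s≤s z≤n)) ⟩
    a + t                       ≡⟨ m+[n∸m]≡n Eₙ₊₁<Eₙ₊₂ ⟩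
    E (2 + n)                   ∎
    where
    open ≡-Reasoning
    a = suc (E (suc n))
    t = E (2 + n) ∸ a
    Eₙ₊₁<Eₙ₊₂ : E (suc n) < E (2 + n)
    Eₙ₊₁<Eₙ₊₂ = inc (suc n) (2 + n) (s≤s z≤n) (n<1+n _)
    rearrange : ∀ x t n → x + t + suc n ≡ suc (x + n) + t
    rearrange = solve-∀
    no-plateau : ∀ j → a ≤ j → j < a + t → ¬ Plateau j
    no-plateau j a≤j j<a+t p with enum-below enum p (subst (j <_) (m+[n∸m]≡n Eₙ₊₁<Eₙ₊₂) j<a+t)
    ... | m , 1≤m , m≤n+1 , Em≡j = <⇒≱ a≤j (subst (_≤ E (suc n)) Em≡j (enum-mono-≤ enum 1≤m m≤n+1))

  module _ (isolated : ∀ i → Plateau i → ¬ Plateau (suc i)) where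

    f-after-plateau : ∀ {i k} → Plateau i → suc i < k → f i < f k
    f-after-plateau {i} {k} pᵢ i+1<k =
      subst (_≤ f k) (trans (¬plateau⇒f-suc (isolated i pᵢ)) (cong suc pᵢ)) (f-mono-≤ i+1<k)

    f-before-plateau : ∀ {i k} → Plateau i → k < i → f k < f i
    f-before-plateau {suc p} {k} pᵢ (s≤s k≤p) =
      subst (f k <_) (sym (¬plateau⇒f-suc λ pₚ → isolated p pₚ pᵢ)) (s≤s (f-mono-≤ k≤p))

    plateau-strict : ∀ {i j} → Plateau i → Plateau j → i < j → f i < f j
    plateau-strict {i} pᵢ pⱼ i<j with m≤n⇒m<n∨m≡n i<j
    ... | inj₂ refl = ⊥-elim (isolated i pᵢ pⱼ)
    ... | inj₁ i+1<j = f-after-plateau pᵢ i+1<j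

    occursTwice⇔plateau : ∀ v → OccursExactlyTwice f v ⇔ (∃[ i ] (Plateau i × f i ≡ v))
    occursTwice⇔plateau v = mk⇔ first-occurrence-is-plateau plateau-value-occurs-twice
      where
      first-occurrence-is-plateau : OccursExactlyTwice f v → ∃[ i ] (Plateau i × f i ≡ v)
      first-occurrence-is-plateau (i , j , i<j , fi≡v , fj≡v , _) =
        i , ≤-antisym (≤-trans (f-mono-≤ i<j) (≤-reflexive (trans fj≡v (sym fi≡v))))
                      (f-mono-≤ (n≤1+n i)) , fi≡v

      plateau-value-occurs-twice : ∃[ i ] (Plateau i × f i ≡ v) → OccursExactlyTwice f v
      plateau-value-occurs-twice (i , pᵢ , refl) = i , suc i , n<1+n i , refl , pᵢ , only
        where
        only : ∀ k → f k ≡ f i → k ≡ i ⊎ k ≡ suc i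
        only k fk≡fi with <-cmp k i
        ... | tri≈ _ k≡i _ = inj₁ k≡i
        ... | tri< k<i _ _ = ⊥-elim (<⇒≢ (f-before-plateau pᵢ k<i) fk≡fi)
        ... | tri> _ _ i<k with m≤n⇒m<n∨m≡n i<k
        ...   | inj₂ refl = inj₂ refl
        ...   | inj₁ i+1<k = ⊥-elim (<⇒≢ (f-after-plateau pᵢ i+1<k) (sym fk≡fi))

-- The recurrence H (i + 1) = i + 1 - H (H (H i))

module Hofstadter (H : ℕ → ℕ) (H0 : H 0 ≡ 0) (H-suc : ∀ i → H (suc i) ≡ suc i ∸ H (H (H i))) where

  H³ : ℕ → ℕ
  H³ i = H (H (H i))

  H≤id : ∀ i → H i ≤ i
  H≤id zero = ≤-reflexive H0
  H≤id (suc i) = subst (_≤ suc i) (sym (H-suc i)) (m∸n≤m (suc i) (H³ i))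

  H³≤id : ∀ i → H³ i ≤ i
  H³≤id i = ≤-trans (H≤id _) (≤-trans (H≤id _) (H≤id i))

  H-suc-from : ∀ {i a b c v} → H i ≡ a → H a ≡ b → H b ≡ c → suc i ∸ c ≡ v → H (suc i) ≡ v
  H-suc-from {i} refl refl refl refl = H-suc i

  H1≡1 : H 1 ≡ 1
  H1≡1 = H-suc-from H0 H0 H0 refl
  H2≡1 : H 2 ≡ 1
  H2≡1 = H-suc-from H1≡1 H1≡1 H1≡1 refl
  H3≡2 : H 3 ≡ 2
  H3≡2 = H-suc-from H2≡1 H1≡1 H1≡1 refl
  H4≡3 : H 4 ≡ 3
  H4≡3 = H-suc-from H3≡2 H2≡1 H1≡1 refl
  H5≡4 : H 5 ≡ 4
  H5≡4 = H-suc-from H4≡3 H3≡2 H2≡1 refl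
  H6≡4 : H 6 ≡ 4
  H6≡4 = H-suc-from H5≡4 H4≡3 H3≡2 refl
  H7≡5 : H 7 ≡ 5
  H7≡5 = H-suc-from H6≡4 H4≡3 H3≡2 refl
  H8≡5 : H 8 ≡ 5
  H8≡5 = H-suc-from H7≡5 H5≡4 H4≡3 refl
  H9≡6 : H 9 ≡ 6
  H9≡6 = H-suc-from H8≡5 H5≡4 H4≡3 refl
  H10≡7 : H 10 ≡ 7
  H10≡7 = H-suc-from H9≡6 H6≡4 H4≡3 refl

  -- H (2 + i) = H (1 + i) + 1 - (H³ (1 + i) - H³ i), and H³ has a unit step at i
  -- because H has one at i, at H i and at H (H i), all of which are at most i.
  H-unit-step : ∀ i → UnitStep (H i) (H (suc i))
  H-unit-step = <-rec (λ i → UnitStep (H i) (H (suc i))) step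
    where
    compose : ∀ {x y} → UnitStep (H x) (H (suc x)) → UnitStep x y → UnitStep (H x) (H y)
    compose _ (inj₁ refl) = inj₁ refl
    compose H-step (inj₂ refl) = H-step

    step : ∀ i → (∀ {j} → j < i → UnitStep (H j) (H (suc j))) → UnitStep (H i) (H (suc i))
    step zero _ = inj₂ (trans H1≡1 (cong suc (sym H0)))
    step (suc i) ih with compose (ih (s≤s (≤-trans (H≤id (H i)) (H≤id i))))
                                 (compose (ih (s≤s (H≤id i))) (ih ≤-refl))
    ... | inj₁ H³-same = inj₂ (begin
      H (2 + i)                 ≡⟨ H-suc (suc i) ⟩
      2 + i ∸ H³ (suc i)        ≡⟨ cong (2 + i ∸_) H³-same ⟩
      2 + i ∸ H³ i              ≡⟨ +-∸-assoc 1 (m≤n⇒m≤1+n (H³≤id i)) ⟩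
      suc (suc i ∸ H³ i)        ≡⟨ cong suc (H-suc i) ⟨
      suc (H (suc i))           ∎)
      where open ≡-Reasoning
    ... | inj₂ H³-suc = inj₁ (trans (H-suc (suc i)) (trans (cong (2 + i ∸_) H³-suc) (sym (H-suc i))))

  open UnitSteps H H-unit-step public

  H-suc-shift : ∀ a b y → H³ (a + b + y) ≡ b + H³ y → H (suc (a + b + y)) ≡ a + H (suc y)
  H-suc-shift a b y H³-shift = begin
    H (suc (a + b + y))                ≡⟨ H-suc (a + b + y) ⟩
    suc (a + b + y) ∸ H³ (a + b + y)   ≡⟨ cong₂ _∸_ (rearrange a b y) H³-shift ⟩
    b + (a + suc y) ∸ (b + H³ y)       ≡⟨ [m+n]∸[m+o]≡n∸o b (a + suc y) (H³ y) ⟩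
    a + suc y ∸ H³ y                   ≡⟨ +-∸-assoc a (m≤n⇒m≤1+n (H³≤id y)) ⟩
    a + (suc y ∸ H³ y)                 ≡⟨ cong (a +_) (H-suc y) ⟨
    a + H (suc y)                      ∎
    where
    open ≡-Reasoning
    rearrange : ∀ a b y → suc (a + b + y) ≡ b + (a + suc y)
    rearrange = solve-∀

  ShiftHolds : ℕ → Set
  ShiftHolds m = ∀ s y → N (3 + s) + y ≡ m → y ≤ N (2 + s) → H (N (3 + s) + y) ≡ N (2 + s) + H y

  module ShiftInduction (m : ℕ) (ih : ∀ {m'} → m' < m → ShiftHolds m') where

    shift< : ∀ s y → N (3 + s) + y < m → y ≤ N (2 + s) → H (N (3 + s) + y) ≡ N (2 + s) + H y
    shift< s y lt = ih lt s y refl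

    H-N< : ∀ k → N (suc k) < m → H (N (suc k)) ≡ N k
    H-N< 0 _ = H2≡1
    H-N< 1 _ = H3≡2
    H-N< 2 _ = H4≡3
    H-N< (suc (suc (suc k))) lt = begin
      H (N (4 + k))                ≡⟨ cong H (+-identityʳ _) ⟨
      H (N (4 + k) + 0)            ≡⟨ shift< (suc k) 0 (subst (_< m) (sym (+-identityʳ _)) lt) z≤n ⟩
      N (3 + k) + H 0              ≡⟨ cong (N (3 + k) +_) H0 ⟩
      N (3 + k) + 0                ≡⟨ +-identityʳ _ ⟩
      N (3 + k)                    ∎
      where open ≡-Reasoning

    H³-shift : ∀ u y → N (5 + u) + y < m → y ≤ N (4 + u) → H³ (N (5 + u) + y) ≡ N (2 + u) + H³ y
    H³-shift u y lt y≤N = begin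
      H (H (H (N (5 + u) + y)))        ≡⟨ cong (H ∘ H) (shift< (2 + u) y lt y≤N) ⟩
      H (H (N (4 + u) + H y))          ≡⟨ cong H (shift< (1 + u) (H y) (smaller (n<1+n _) (H≤id y)) Hy≤N) ⟩
      H (N (3 + u) + H (H y))          ≡⟨ shift< u (H (H y)) (smaller 3+u<5+u (≤-trans (H≤id _) (H≤id y))) HHy≤N ⟩
      N (2 + u) + H³ y                 ∎
      where
      open ≡-Reasoning
      3+u<5+u : 3 + u < 5 + u
      3+u<5+u = m<n+m (3 + u) {2} (s≤s z≤n)
      smaller : ∀ {j z} → j < 5 + u → z ≤ y → N j + z < m
      smaller j<5+u z≤y = <-≤-trans (+-mono-<-≤ (N-mono-< j<5+u) z≤y) (<⇒≤ lt)
      N< : ∀ {j} → j < 5 + u → N j < m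
      N< j<5+u = ≤-<-trans (m≤m+n _ 0) (smaller j<5+u z≤n)
      Hy≤N : H y ≤ N (3 + u)
      Hy≤N = ≤-trans (f-mono-≤ y≤N) (≤-reflexive (H-N< (3 + u) (N< ≤-refl)))
      HHy≤N : H (H y) ≤ N (2 + u)
      HHy≤N = ≤-trans (f-mono-≤ Hy≤N) (≤-reflexive (H-N< (2 + u) (N< 3+u<5+u)))

    -- For s ≤ 1 the three shifts inside H³ would need the (false) shift at N 2 or N 1,
    -- e.g. H (3 + 2) ≠ 2 + H 2, so those few cases are read off the table of values.
    shift-positive : ∀ s y → 1 ≤ y → N (3 + s) + y ≡ m → y ≤ N (2 + s)
                     → H (N (3 + s) + y) ≡ N (2 + s) + H y
    shift-positive 0 1 _ _ _ = trans H5≡4 (cong (3 +_) (sym H1≡1))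
    shift-positive 0 2 _ _ _ = trans H6≡4 (cong (3 +_) (sym H2≡1))
    shift-positive 0 3 _ _ _ = trans H7≡5 (cong (3 +_) (sym H3≡2))
    shift-positive 1 1 _ _ _ = trans H7≡5 (cong (4 +_) (sym H1≡1))
    shift-positive 1 2 _ _ _ = trans H8≡5 (cong (4 +_) (sym H2≡1))
    shift-positive 1 3 _ _ _ = trans H9≡6 (cong (4 +_) (sym H3≡2))
    shift-positive 1 4 _ _ _ = trans H10≡7 (cong (4 +_) (sym H4≡3))
    shift-positive 0 (suc (suc (suc (suc _)))) _ _ (s≤s (s≤s (s≤s ())))
    shift-positive 1 (suc (suc (suc (suc (suc _))))) _ _ (s≤s (s≤s (s≤s (s≤s ()))))
    shift-positive (suc (suc u)) (suc y) _ ≡m y<N = begin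
      H (N (5 + u) + suc y)     ≡⟨ cong H (+-suc (N (5 + u)) y) ⟩
      H (suc (N (5 + u) + y))   ≡⟨ H-suc-shift (N (4 + u)) (N (2 + u)) y (H³-shift u y lt (<⇒≤ y<N)) ⟩
      N (4 + u) + H (suc y)     ∎
      where
      open ≡-Reasoning
      lt : N (5 + u) + y < m
      lt = subst (N (5 + u) + y <_) ≡m (+-monoʳ-< (N (5 + u)) (n<1+n y))

    -- N (4 + s) = N (3 + s) + N (1 + s) turns the case y = 0 into a positive case.
    shift-holds : ShiftHolds m
    shift-holds 0 0 _ _ = trans H4≡3 (cong (3 +_) (sym H0))
    shift-holds (suc s) 0 ≡m _ = begin
      H (N (4 + s) + 0)           ≡⟨ cong H (+-identityʳ _) ⟩
      H (N (3 + s) + N (1 + s))   ≡⟨ shift-positive s (N (1 + s)) (1≤N (1 + s)) ≡m′ (<⇒≤ (N<N[1+k] (1 + s))) ⟩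
      N (2 + s) + H (N (1 + s))   ≡⟨ cong (N (2 + s) +_) (H-N< s N₁₊ₛ<m) ⟩
      N (3 + s)                   ≡⟨ +-identityʳ _ ⟨
      N (3 + s) + 0               ≡⟨ cong (N (3 + s) +_) H0 ⟨
      N (3 + s) + H 0             ∎
      where
      open ≡-Reasoning
      ≡m′ : N (3 + s) + N (1 + s) ≡ m
      ≡m′ = trans (sym (+-identityʳ _)) ≡m
      N₁₊ₛ<m : N (1 + s) < m
      N₁₊ₛ<m = <-≤-trans (N-mono-< (m<n+m (1 + s) {3} (s≤s z≤n))) (subst (N (4 + s) ≤_) ≡m (m≤m+n _ 0))
    shift-holds s (suc y) ≡m y<N = shift-positive s (suc y) (s≤s z≤n) ≡m y<N

  H-shift : ∀ s y → y ≤ N (2 + s) → H (N (3 + s) + y) ≡ N (2 + s) + H y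
  H-shift s y = <-rec ShiftHolds ShiftInduction.shift-holds (N (3 + s) + y) s y refl

  ¬plateau-0 : ¬ Plateau 0
  ¬plateau-0 p = 1+n≢0 (trans (sym H1≡1) (trans p H0))

  plateau-1 : Plateau 1
  plateau-1 = trans H2≡1 (sym H1≡1)

  ¬plateau-2 : ¬ Plateau 2
  ¬plateau-2 p = 1+n≢n (trans (sym H3≡2) (trans p H2≡1))

  ¬plateau-3 : ¬ Plateau 3
  ¬plateau-3 p = 1+n≢n (trans (sym H4≡3) (trans p H3≡2))

  plateau-shift : ∀ s y → suc y ≤ N (2 + s) → Plateau (N (3 + s) + y) ⇔ Plateau y
  plateau-shift s y y<N = mk⇔
    (λ p → +-cancelˡ-≡ (N (2 + s)) _ _ (trans (sym shift-suc) (trans p shift)))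
    (λ p → trans shift-suc (trans (cong (N (2 + s) +_) p) (sym shift)))
    where
    shift : H (N (3 + s) + y) ≡ N (2 + s) + H y
    shift = H-shift s y (<⇒≤ y<N)
    shift-suc : H (suc (N (3 + s) + y)) ≡ N (2 + s) + H (suc y)
    shift-suc = trans (cong H (sym (+-suc (N (3 + s)) y))) (H-shift s (suc y) y<N)

  plateau-N : ∀ k → Plateau (N k) ⇔ k ≡ 0
  plateau-N 0 = mk⇔ (λ _ → refl) (λ _ → plateau-1)
  plateau-N 1 = mk⇔ (⊥-elim ∘ ¬plateau-2) λ ()
  plateau-N 2 = mk⇔ (⊥-elim ∘ ¬plateau-3) λ ()
  plateau-N (suc (suc (suc s))) = mk⇔ (⊥-elim ∘ ¬plateau-0 ∘ drop-N) λ ()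
    where
    drop-N : Plateau (N (3 + s)) → Plateau 0
    drop-N = to (plateau-shift s 0 (1≤N (2 + s))) ∘ subst Plateau (sym (+-identityʳ _))

  plateau-isolated : ∀ i → Plateau i → ¬ Plateau (suc i)
  plateau-isolated =
    narayana-induction (λ i → Plateau i → ¬ Plateau (suc i)) (⊥-elim ∘ ¬plateau-0) at-N shifted
    where
    at-N : ∀ k → Plateau (N k) → ¬ Plateau (suc (N k))
    at-N zero _ = ¬plateau-2
    at-N (suc k) p = ⊥-elim (1+n≢0 (to (plateau-N (suc k)) p))
    shifted : ∀ s y → 1 ≤ y → y < N (suc s) → (Plateau y → ¬ Plateau (suc y))
              → Plateau (N (3 + s) + y) → ¬ Plateau (suc (N (3 + s) + y))
    shifted s y _ y<N isolated-y p p' = isolated-y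
      (to (plateau-shift s y (<-trans y<N (N<N[1+k] (suc s)))) p)
      (to (plateau-shift s (suc y) (<-≤-trans (s≤s y<N) (N<N[1+k] (suc s))))
          (subst Plateau (sym (+-suc _ y)) p'))

  plateau⇔NarEndsIn1 : ∀ m → Plateau m ⇔ NarEndsIn1 m
  plateau⇔NarEndsIn1 = narayana-induction (λ m → Plateau m ⇔ NarEndsIn1 m)
    (mk⇔ (⊥-elim ∘ ¬plateau-0) λ { (() , _) })
    (λ k → ⇔-sym (NarEndsIn1-N k) ⇔-∘ plateau-N k)
    (λ s y 1≤y y<N y-equiv → ⇔-sym (NarEndsIn1-shift s y 1≤y y<N) ⇔-∘ (y-equiv
                              ⇔-∘ plateau-shift s y (<-trans y<N (N<N[1+k] (suc s)))))

theorem38 : (H : ℕ → ℕ) → H 0 ≡ 0 → (∀ i → H (suc i) ≡ suc i ∸ H (H (H i)))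
            → (A B : ℕ → ℕ)
            → IsIncreasingEnumeration (OccursExactlyTwice H) A
            → IsIncreasingEnumeration NarEndsIn1 B
            → ∀ n → 1 ≤ n → A n + n ∸ 1 ≡ B n
theorem38 H H0 H-suc A B enumA enumB n 1≤n = begin
  A n + n ∸ 1         ≡⟨ +-∸-assoc (A n) 1≤n ⟩
  A n + (n ∸ 1)       ≡⟨ cong (_+ (n ∸ 1)) (enum-unique enumA enum-H∘B n 1≤n) ⟩
  H (B n) + (n ∸ 1)   ≡⟨ f[E[n]]+[n∸1]≡E[n] H0 enum-B n 1≤n ⟩
  B n                 ∎
  where
  open ≡-Reasoning
  open Hofstadter H H0 H-suc
  enum-B : IsIncreasingEnumeration Plateau B
  enum-B = enum-cong (λ m → ⇔-sym (plateau⇔NarEndsIn1 m)) enumB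
  enum-H∘B : IsIncreasingEnumeration (OccursExactlyTwice H) (λ n → H (B n))
  enum-H∘B = enum-cong (λ v → ⇔-sym (occursTwice⇔plateau plateau-isolated v))
                       (enum-map H enum-B (plateau-strict plateau-isolated))
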